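{- For every integer $\nu\ge1$ let $a=2^\nu+1$, $b=2^\nu-1$ and $$A_\nu=\frac{1}{\log(2)}\log\Bigl(\frac{(2^\nu+1)^\nu-1}{2^\nu-1}\Bigr).$$ Then $a^\nu-1=2^{A_\nu}b$; for $\nu=1$, $A_\nu=\nu(\nu-1)+1=1$; for $\nu=2$, $A_\nu=\nu(\nu-1)+1=3$; for every $\nu\ge3$, $$\nu(\nu-1)<A_\nu<\nu(\nu-1)+1,$$ so $\lfloor A_\nu\rfloor=\nu(\nu-1)$; and $A_\nu\sim\nu(\nu-1)$ as $\nu\to\infty$. -}

module Defs where

open import Data.Nat using (ℕ; zero; suc; _+_; _*_; _∸_; _^_; _<_; NonZero; >-nonZero)
open import Data.Nat.DivMod using (_/_)
open import Data.Nat.Properties using (m^n>0; m≤n+m; ≤-trans)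

aν : ℕ → ℕ
aν ν = 2 ^ ν + 1

bν : ℕ → ℕ
bν ν = 2 ^ ν ∸ 1

private
  pos : ∀ x → 0 < x → 0 < x + (x + 0) ∸ 1
  pos (suc x) _ = ≤-trans (Data.Nat.s≤s Data.Nat.z≤n) (m≤n+m (suc x + 0) x)

bν-nonZero : ∀ ν → .{{NonZero ν}} → NonZero (bν ν)
bν-nonZero (suc k) = >-nonZero (pos (2 ^ k) (m^n>0 2 k))

-- N_ν = (a_ν^ν - 1) / b_ν  (natural-number division).
-- The paper's A_ν is log₂ N_ν, i.e. A_ν is defined by 2^{A_ν} = N_ν.
Nν : (ν : ℕ) → .{{NonZero ν}} → ℕ
Nν ν = _/_ (aν ν ^ ν ∸ 1) (bν ν) {{bν-nonZero ν}}

module Submission where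

-- Put b = 2^ν − 1, so that a = b + 2 and a^ν ≡ 2^ν = b + 1 (mod b): b divides a^ν − 1 and
-- N = (a^ν − 1)/b is exact, with b N + 1 = (b + 2)^ν.  With B = b + 1 = 2^ν the binomial
-- expansion gives B^ν < (B + 1)^ν ≤ B^ν + (2ν − 1) B^(ν−1), and once 2ν + 2 ≤ b (that is,
-- ν ≥ 3) this traps N strictly between B^(ν−1) = 2^(ν(ν−1)) and 2 B^(ν−1).

open import Defs
open import Data.Nat using (ℕ; zero; suc; _+_; _*_; _∸_; _^_; _<_; _≤_; NonZero; z≤n; s≤s; ⌊_/2⌋)
open import Data.Nat.DivMod using (_/_; m*n/n≡m)
open import Data.Nat.Logarithm using (⌊log₂_⌋; ⌊log₂⌋-mono-≤; ⌊log₂⌊n/2⌋⌋≡⌊log₂n⌋∸1; ⌊log₂[2^n]⌋≡n)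
open import Data.Nat.Properties
open import Data.Nat.Tactic.RingSolver using (solve-∀)
open import Data.Product using (_×_; ∃; _,_)
open import Relation.Binary.PropositionalEquality using (_≡_; refl; sym; trans; cong; subst; module ≡-Reasoning)

[m+d]^n≡m^n+d*q : ∀ m d n → ∃ λ q → (m + d) ^ n ≡ m ^ n + d * q
[m+d]^n≡m^n+d*q m d zero = 0 , cong suc (sym (*-zeroʳ d))
[m+d]^n≡m^n+d*q m d (suc n) with [m+d]^n≡m^n+d*q m d n
... | q , eq = m ^ n + q * (m + d) , (begin
    (m + d) * (m + d) ^ n           ≡⟨ cong ((m + d) *_) eq ⟩
    (m + d) * (m ^ n + d * q)       ≡⟨ regroup m d (m ^ n) q ⟩
    m * m ^ n + d * (m ^ n + q * (m + d)) ∎)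
  where
  open ≡-Reasoning
  regroup : ∀ m d p q → (m + d) * (p + d * q) ≡ m * p + d * (p + q * (m + d))
  regroup = solve-∀

[1+y]^[1+j]≤y^[1+j]+[2j+1]*y^j : ∀ y j → 2 * j + 1 ≤ y →
                                  suc y ^ suc j ≤ y ^ suc j + (2 * j + 1) * y ^ j
[1+y]^[1+j]≤y^[1+j]+[2j+1]*y^j y zero _ = ≤-reflexive (+-comm 1 (y * 1))
[1+y]^[1+j]≤y^[1+j]+[2j+1]*y^j y (suc j) 2j+3≤y = begin
    suc y * suc y ^ suc j
  ≤⟨ *-monoʳ-≤ (suc y) ([1+y]^[1+j]≤y^[1+j]+[2j+1]*y^j y j 2j+1≤y) ⟩
    suc y * (y * p + (2 * j + 1) * p)
  ≡⟨ expand y j p ⟩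
    y * (y * p) + (2 * j + 2) * (y * p) + (2 * j + 1) * p
  ≤⟨ +-monoʳ-≤ (y * (y * p) + (2 * j + 2) * (y * p)) (*-monoˡ-≤ p 2j+1≤y) ⟩
    y * (y * p) + (2 * j + 2) * (y * p) + y * p
  ≡⟨ collect y j p ⟩
    y * (y * p) + (2 * suc j + 1) * (y * p)
  ∎
  where
  open ≤-Reasoning
  p = y ^ j
  2j+1≤y : 2 * j + 1 ≤ y
  2j+1≤y = ≤-trans (+-monoˡ-≤ 1 (*-monoʳ-≤ 2 (n≤1+n j))) 2j+3≤y
  expand : ∀ y j p → suc y * (y * p + (2 * j + 1) * p)
                     ≡ y * (y * p) + (2 * j + 2) * (y * p) + (2 * j + 1) * p
  expand = solve-∀
  collect : ∀ y j p → y * (y * p) + (2 * j + 2) * (y * p) + y * p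
                      ≡ y * (y * p) + (2 * suc j + 1) * (y * p)
  collect = solve-∀

2*m+3≤2^[1+m] : ∀ m → 2 ≤ m → 2 * m + 3 ≤ 2 ^ suc m
2*m+3≤2^[1+m] 2 _ = m≤m+n 7 1
2*m+3≤2^[1+m] 1 (s≤s ())
2*m+3≤2^[1+m] (suc (suc (suc m))) _ = begin
    2 * (3 + m) + 3                ≤⟨ m≤m+n (2 * (3 + m) + 3) (2 * m + 5) ⟩
    2 * (3 + m) + 3 + (2 * m + 5)  ≡⟨ double m ⟩
    2 * (2 * (2 + m) + 3)          ≤⟨ *-monoʳ-≤ 2 (2*m+3≤2^[1+m] (suc (suc m)) (s≤s (s≤s z≤n))) ⟩
    2 * 2 ^ (3 + m)                ∎
  where
  open ≤-Reasoning
  double : ∀ m → 2 * (3 + m) + 3 + (2 * m + 5) ≡ 2 * (2 * (2 + m) + 3)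
  double = solve-∀

module _ {b Q m : ℕ} (bQ+1≡[b+2]^[m+1] : suc (b * Q) ≡ suc (suc b) ^ suc m) where
  open ≤-Reasoning

  [b+1]^m<Q : suc b ^ m < Q
  [b+1]^m<Q = *-cancelˡ-< b (suc b ^ m) Q (≤-pred (begin-strict
      suc (b * p)                 ≡⟨ +-comm 1 (b * p) ⟩
      b * p + 1                   ≤⟨ +-monoʳ-≤ (b * p) (m^n>0 (suc b) m) ⟩
      b * p + p                   ≡⟨ +-comm (b * p) p ⟩
      suc b ^ suc m               <⟨ ^-monoˡ-< (suc m) (n<1+n (suc b)) ⟩
      suc (suc b) ^ suc m         ≡⟨ sym bQ+1≡[b+2]^[m+1] ⟩
      suc (b * Q)                 ∎))
    where p = suc b ^ m

  Q<2*[b+1]^m : 2 * m + 2 ≤ b → Q < 2 * suc b ^ m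
  Q<2*[b+1]^m 2m+2≤b = *-cancelˡ-< b Q (2 * p) (begin-strict
      b * Q                          <⟨ n<1+n (b * Q) ⟩
      suc (b * Q)                    ≡⟨ bQ+1≡[b+2]^[m+1] ⟩
      suc (suc b) ^ suc m            ≤⟨ [1+y]^[1+j]≤y^[1+j]+[2j+1]*y^j (suc b) m 2m+1≤b+1 ⟩
      suc b * p + (2 * m + 1) * p    ≡⟨ shift b m p ⟩
      b * p + (2 * m + 2) * p        ≤⟨ +-monoʳ-≤ (b * p) (*-monoˡ-≤ p 2m+2≤b) ⟩
      b * p + b * p                  ≡⟨ twice b p ⟩
      b * (2 * p)                    ∎)
    where
    p = suc b ^ m
    2m+1≤b+1 : 2 * m + 1 ≤ suc b
    2m+1≤b+1 = ≤-trans (+-monoʳ-≤ (2 * m) (s≤s z≤n)) (m≤n⇒m≤1+n 2m+2≤b)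
    shift : ∀ b m p → suc b * p + (2 * m + 1) * p ≡ b * p + (2 * m + 2) * p
    shift = solve-∀
    twice : ∀ b p → b * p + b * p ≡ b * (2 * p)
    twice = solve-∀

1+bν≡2^ν : ∀ m → suc (bν (suc m)) ≡ 2 ^ suc m
1+bν≡2^ν m = trans (+-comm 1 (bν (suc m))) (m∸n+n≡m (m^n>0 2 (suc m)))

aν≡2+bν : ∀ m → aν (suc m) ≡ 2 + bν (suc m)
aν≡2+bν m = trans (cong (_+ 1) (sym (1+bν≡2^ν m))) (+-comm (suc (bν (suc m))) 1)

aν^ν≡1+bν*[1+q] : ∀ m → ∃ λ q → aν (suc m) ^ suc m ≡ suc (bν (suc m) * suc q)
aν^ν≡1+bν*[1+q] m with [m+d]^n≡m^n+d*q 2 (bν (suc m)) (suc m)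
... | q , [2+b]^ν≡2^ν+bq = q , (begin
    aν (suc m) ^ suc m     ≡⟨ cong (_^ suc m) (aν≡2+bν m) ⟩
    (2 + b) ^ suc m        ≡⟨ [2+b]^ν≡2^ν+bq ⟩
    2 ^ suc m + b * q      ≡⟨ cong (_+ b * q) (1+bν≡2^ν m) ⟨
    suc b + b * q          ≡⟨ cong suc (*-suc b q) ⟨
    suc (b * suc q)        ∎)
  where
  open ≡-Reasoning
  b = bν (suc m)

aν^ν≡1+bν*Nν : ∀ m → aν (suc m) ^ suc m ≡ suc (bν (suc m) * Nν (suc m))
aν^ν≡1+bν*Nν m with aν^ν≡1+bν*[1+q] m
... | q , eq = trans eq (cong (λ n → suc (b * n)) (sym Nν≡1+q))
  where
  b = bν (suc m)
  Nν≡1+q : Nν (suc m) ≡ suc q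
  Nν≡1+q = begin
    Nν (suc m)                               ≡⟨ cong (λ n → _/_ (n ∸ 1) b {{bν-nonZero (suc m)}}) eq ⟩
    _/_ (b * suc q) b {{bν-nonZero (suc m)}} ≡⟨ cong (λ n → _/_ n b {{bν-nonZero (suc m)}}) (*-comm b (suc q)) ⟩
    _/_ (suc q * b) b {{bν-nonZero (suc m)}} ≡⟨ m*n/n≡m (suc q) b {{bν-nonZero (suc m)}} ⟩
    suc q                                    ∎
    where open ≡-Reasoning

Nν*bν≡aν^ν∸1 : (ν : ℕ) → .{{_ : NonZero ν}} → Nν ν * bν ν ≡ aν ν ^ ν ∸ 1
Nν*bν≡aν^ν∸1 (suc m) = trans (*-comm (Nν (suc m)) (bν (suc m))) (cong (_∸ 1) (sym (aν^ν≡1+bν*Nν m)))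

Nν-bounds : (ν : ℕ) → .{{_ : NonZero ν}} → 3 ≤ ν →
            2 ^ (ν * (ν ∸ 1)) < Nν ν × Nν ν < 2 ^ (ν * (ν ∸ 1) + 1)
Nν-bounds (suc m) (s≤s 2≤m) = lower , upper
  where
  b = bν (suc m)
  E = suc m * m
  bN+1≡[b+2]^ν : suc (b * Nν (suc m)) ≡ suc (suc b) ^ suc m
  bN+1≡[b+2]^ν = trans (sym (aν^ν≡1+bν*Nν m)) (cong (_^ suc m) (aν≡2+bν m))
  2^E≡[b+1]^m : 2 ^ E ≡ suc b ^ m
  2^E≡[b+1]^m = trans (sym (^-*-assoc 2 (suc m) m)) (cong (_^ m) (sym (1+bν≡2^ν m)))
  2m+2≤b : 2 * m + 2 ≤ b
  2m+2≤b = ≤-pred (begin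
    suc (2 * m + 2)  ≡⟨ +-suc (2 * m) 2 ⟨
    2 * m + 3        ≤⟨ 2*m+3≤2^[1+m] m 2≤m ⟩
    2 ^ suc m        ≡⟨ 1+bν≡2^ν m ⟨
    suc b            ∎)
    where open ≤-Reasoning
  lower : 2 ^ E < Nν (suc m)
  lower = subst (_< Nν (suc m)) (sym 2^E≡[b+1]^m) ([b+1]^m<Q {b} {Nν (suc m)} {m} bN+1≡[b+2]^ν)
  upper : Nν (suc m) < 2 ^ (E + 1)
  upper = subst (Nν (suc m) <_) (trans (cong (2 *_) (sym 2^E≡[b+1]^m)) (cong (2 ^_) (+-comm 1 E)))
                (Q<2*[b+1]^m {b} {Nν (suc m)} {m} bN+1≡[b+2]^ν 2m+2≤b)

m<n+n⇒⌊m/2⌋<n : ∀ m n → m < n + n → ⌊ m /2⌋ < n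
m<n+n⇒⌊m/2⌋<n zero          (suc n) _ = s≤s z≤n
m<n+n⇒⌊m/2⌋<n (suc zero)    (suc n) _ = s≤s z≤n
m<n+n⇒⌊m/2⌋<n (suc (suc m)) (suc n) (s≤s m+2≤n+n+1) =
  s≤s (m<n+n⇒⌊m/2⌋<n m n (≤-pred (≤-trans m+2≤n+n+1 (≤-reflexive (+-suc n n)))))

n<2^[1+k]⇒⌊log₂n⌋≤k : ∀ k n → n < 2 ^ suc k → ⌊log₂ n ⌋ ≤ k
n<2^[1+k]⇒⌊log₂n⌋≤k zero    n n<2 = ⌊log₂⌋-mono-≤ (≤-pred n<2)
n<2^[1+k]⇒⌊log₂n⌋≤k (suc k) n n<2^[2+k] = begin
    ⌊log₂ n ⌋                ≤⟨ m≤n+m∸n ⌊log₂ n ⌋ 1 ⟩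
    suc (⌊log₂ n ⌋ ∸ 1)      ≡⟨ cong suc (⌊log₂⌊n/2⌋⌋≡⌊log₂n⌋∸1 n) ⟨
    suc ⌊log₂ ⌊ n /2⌋ ⌋      ≤⟨ s≤s (n<2^[1+k]⇒⌊log₂n⌋≤k k ⌊ n /2⌋ ⌊n/2⌋<2^[1+k]) ⟩
    suc k                    ∎
  where
  open ≤-Reasoning
  ⌊n/2⌋<2^[1+k] : ⌊ n /2⌋ < 2 ^ suc k
  ⌊n/2⌋<2^[1+k] = m<n+n⇒⌊m/2⌋<n n (2 ^ suc k)
                    (≤-trans n<2^[2+k] (≤-reflexive (cong (2 ^ suc k +_) (+-identityʳ (2 ^ suc k)))))

2^k≤n<2^[1+k]⇒⌊log₂n⌋≡k : ∀ k n → 2 ^ k ≤ n → n < 2 ^ suc k → ⌊log₂ n ⌋ ≡ k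
2^k≤n<2^[1+k]⇒⌊log₂n⌋≡k k n 2^k≤n n<2^[1+k] = ≤-antisym
  (n<2^[1+k]⇒⌊log₂n⌋≤k k n n<2^[1+k])
  (≤-trans (≤-reflexive (sym (⌊log₂[2^n]⌋≡n k))) (⌊log₂⌋-mono-≤ 2^k≤n))

⌊log₂Nν⌋≡ν[ν-1] : (ν : ℕ) → .{{_ : NonZero ν}} → 3 ≤ ν → ⌊log₂ Nν ν ⌋ ≡ ν * (ν ∸ 1)
⌊log₂Nν⌋≡ν[ν-1] ν 3≤ν with Nν-bounds ν 3≤ν
... | lower , upper = 2^k≤n<2^[1+k]⇒⌊log₂n⌋≡k E (Nν ν) (<⇒≤ lower)
                        (subst (Nν ν <_) (cong (2 ^_) (+-comm E 1)) upper)
  where E = ν * (ν ∸ 1)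

^-bounds : ∀ k .{{_ : NonZero k}} {E n} → 2 ^ E < n → n < 2 ^ (E + 1) →
           2 ^ (k * E) < n ^ k × n ^ k < 2 ^ (k * E + k)
^-bounds k {E} {n} 2^E<n n<2^[E+1] = lower , upper
  where
  open ≤-Reasoning
  lower : 2 ^ (k * E) < n ^ k
  lower = begin-strict
    2 ^ (k * E)     ≡⟨ cong (2 ^_) (*-comm k E) ⟩
    2 ^ (E * k)     ≡⟨ ^-*-assoc 2 E k ⟨
    (2 ^ E) ^ k     <⟨ ^-monoˡ-< k 2^E<n ⟩
    n ^ k           ∎
  upper : n ^ k < 2 ^ (k * E + k)
  upper = begin-strict
    n ^ k               <⟨ ^-monoˡ-< k n<2^[E+1] ⟩
    (2 ^ (E + 1)) ^ k   ≡⟨ ^-*-assoc 2 (E + 1) k ⟩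
    2 ^ ((E + 1) * k)   ≡⟨ cong (2 ^_) (distribute E k) ⟩
    2 ^ (k * E + k)     ∎
    where
    distribute : ∀ E k → (E + 1) * k ≡ k * E + k
    distribute = solve-∀

Nν^k-bounds : (k : ℕ) → 1 ≤ k → ∃ λ M → (ν : ℕ) → .{{_ : NonZero ν}} → M ≤ ν →
              2 ^ (k * (ν * (ν ∸ 1)) ∸ ν * (ν ∸ 1)) < Nν ν ^ k
              × Nν ν ^ k < 2 ^ (k * (ν * (ν ∸ 1)) + ν * (ν ∸ 1))
Nν^k-bounds k@(suc _) _ = 3 + k , bounds
  where
  bounds : (ν : ℕ) → .{{_ : NonZero ν}} → 3 + k ≤ ν →
           2 ^ (k * (ν * (ν ∸ 1)) ∸ ν * (ν ∸ 1)) < Nν ν ^ k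
           × Nν ν ^ k < 2 ^ (k * (ν * (ν ∸ 1)) + ν * (ν ∸ 1))
  bounds (suc m) 3+k≤1+m with Nν-bounds (suc m) (≤-trans (m≤m+n 3 k) 3+k≤1+m)
  ... | 2^E<N , N<2^[E+1] with ^-bounds k {suc m * m} 2^E<N N<2^[E+1]
  ... | lower , upper =
      ≤-<-trans (^-monoʳ-≤ 2 (m∸n≤m (k * E) E)) lower
    , <-≤-trans upper (^-monoʳ-≤ 2 (+-monoʳ-≤ (k * E) k≤E))
    where
    E = suc m * m
    k≤E : k ≤ E
    k≤E = ≤-trans (≤-trans (m≤n+m k 2) (≤-pred 3+k≤1+m)) (m≤m+n m (m * m))

mainTheorem11 : ((ν : ℕ) → .{{_ : NonZero ν}} → Nν ν * bν ν ≡ aν ν ^ ν ∸ 1)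
    × (Nν 1 ≡ 2 ^ 1 × 1 * (1 ∸ 1) + 1 ≡ 1)
    × (Nν 2 ≡ 2 ^ 3 × 2 * (2 ∸ 1) + 1 ≡ 3)
    × ((ν : ℕ) → .{{_ : NonZero ν}} → 3 ≤ ν →
    (2 ^ (ν * (ν ∸ 1)) < Nν ν × Nν ν < 2 ^ (ν * (ν ∸ 1) + 1))
    × ⌊log₂ Nν ν ⌋ ≡ ν * (ν ∸ 1))
    × ((k : ℕ) → 1 ≤ k → ∃ λ M → (ν : ℕ) → .{{_ : NonZero ν}} → M ≤ ν →
    2 ^ (k * (ν * (ν ∸ 1)) ∸ ν * (ν ∸ 1)) < Nν ν ^ k
    × Nν ν ^ k < 2 ^ (k * (ν * (ν ∸ 1)) + ν * (ν ∸ 1)))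
mainTheorem11 =
    Nν*bν≡aν^ν∸1
  , (refl , refl)
  , (refl , refl)
  , (λ ν 3≤ν → Nν-bounds ν 3≤ν , ⌊log₂Nν⌋≡ν[ν-1] ν 3≤ν)
  , Nν^k-bounds
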